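{- Let $X$ and $Y$ be strings and let $\tilde X=X[i':i'']$ and $\tilde Y=Y[j':j'']$ with $i'<i''$. Let $\bar\imath=\lfloor (i'+i'')/2\rfloor$, $X'=X[i':\bar\imath]$, $X''=X[\bar\imath+1:i'']$, and let $\bar\jmath$ be the least index $j$ with $j'-1\le j\le j''$ such that $L(X',Y[j':j])+L(X'',Y[j+1:j''])=L(\tilde X,\tilde Y)$. Let $Y'=Y[j':\bar\jmath]$ and $Y''=Y[\bar\jmath+1:j'']$. If $\tilde P$, $P'$, $P''$ are the first elements of $\mathcal{P}(\tilde X,\tilde Y)$, $\mathcal{P}(X',Y')$, $\mathcal{P}(X'',Y'')$ respectively, then $\tilde P=P'\circ P''$.
   Context: For a sequence $S$, $|S|$ is its length, $S[i]$ its $i$th element, $S[i:i']=S[i]\circ\cdots\circ S[i']$ for $1\le i\le i'+1\le|S|+1$ (empty if $i=i'+1$), and for an index sequence $I=i_1\circ\cdots\circ i_\ell$ with $i_1<\dots<i_\ell$, $S[I]=S[i_1]\circ\cdots\circ S[i_\ell]$. A subsequence is obtained by deleting zero or more elements at arbitrary positions. $L(A,B)$ denotes the length of a longest common subsequence (LCS) of strings $A,B$ (zero if either is empty). For a contiguous subsequence $\tilde X$ of $X$ and a contiguous subsequence $\tilde Y=Y[j':j'']$ of $Y$, an LCS-position sequence of $\tilde X$ and $\tilde Y$ is a sequence $P$ of $L(\tilde X,\tilde Y)$ increasing indices between $j'$ and $j''$ such that $Y[P]$ is an LCS of $\tilde X$ and $\tilde Y$ and, for every $k$ with $1\le k\le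 L(\tilde X,\tilde Y)$, $Y[j':P[k]]$ is the shortest prefix of $\tilde Y$ having $Y[P[1:k]]$ as a subsequence. $\mathcal{P}(\tilde X,\tilde Y)$ denotes the sequence of all LCS-position sequences of $\tilde X$ and $\tilde Y$ in lexicographic order. -}

module Defs where

open import Data.Nat using (ℕ; zero; suc; _+_; _∸_; _≤_; _<_; _⊔_)
open import Data.Fin using (Fin; toℕ)
open import Data.List using (List; []; _∷_; _++_; length; take; drop; map; filter; foldr; concatMap; lookup)
open import Data.List.Relation.Binary.Sublist.Propositional using (_⊆_)
import Data.List.Relation.Binary.Sublist.DecPropositional as DecSub
open import Data.List.Relation.Unary.All using (All)
open import Data.List.Relation.Unary.Linked using (Linked)
open import Data.List.Relation.Binary.Lex.NonStrict using (Lex-≤)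
open import Data.Product using (_×_)
open import Relation.Binary.Definitions using (DecidableEquality)
open import Relation.Binary.PropositionalEquality using (_≡_)
open import Relation.Nullary using (¬_)

-- Strings are lists over an alphabet A; positions are 1-based.
-- sub S i i' = S[i:i'] = S[i] ∘ ⋯ ∘ S[i']  (empty when i' < i).
sub : {A : Set} → List A → ℕ → ℕ → List A
sub S i i' = take (suc i' ∸ i) (drop (i ∸ 1) S)

select : {A : Set} → List A → List ℕ → List A
select S I = concatMap (λ i → sub S i i) I

subseqs : {A : Set} → List A → List (List A)
subseqs []       = [] ∷ []
subseqs (x ∷ xs) = map (x ∷_) (subseqs xs) ++ subseqs xs

maximum : List ℕ → ℕ
maximum = foldr _⊔_ 0

L : {A : Set} → DecidableEquality A → List A → List A → ℕ
L _≟_ U V = maximum (map length (filter (λ s → DecSub._⊆?_ _≟_ s V) (subseqs U)))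

IsLCS : {A : Set} → DecidableEquality A → List A → List A → List A → Set
IsLCS _≟_ S U V = (S ⊆ U) × (S ⊆ V) × (length S ≡ L _≟_ U V)

IsLCSPos : {A : Set} → DecidableEquality A →
           (X̃ Y : List A) (j' j'' : ℕ) → List ℕ → Set
IsLCSPos _≟_ X̃ Y j' j'' P =
    (length P ≡ L _≟_ X̃ (sub Y j' j''))
  × Linked _<_ P
  × All (λ p → (j' ≤ p) × (p ≤ j'')) P
  × IsLCS _≟_ (select Y P) X̃ (sub Y j' j'')
  × ((k : Fin (length P)) →
        (select Y (take (suc (toℕ k)) P) ⊆ sub Y j' (lookup P k))
      × ((m : ℕ) → m < lookup P k →
           ¬ (select Y (take (suc (toℕ k)) P) ⊆ sub Y j' m)))

_≤lex_ : List ℕ → List ℕ → Set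
_≤lex_ = Lex-≤ _≡_ _≤_

IsFirstLCSPos : {A : Set} → DecidableEquality A →
                (X̃ Y : List A) (j' j'' : ℕ) → List ℕ → Set
IsFirstLCSPos _≟_ X̃ Y j' j'' P =
    IsLCSPos _≟_ X̃ Y j' j'' P
  × ((Q : List ℕ) → IsLCSPos _≟_ X̃ Y j' j'' Q → P ≤lex Q)

-- A chain is a list of matches (i , j), X[i] = Y[j], increasing in both coordinates; in a box it
-- is optimal when its length is the LCS length of the box.  The column sequence of an optimal
-- chain lies pointwise to the right of the greedy (leftmost) embedding of its word, and that
-- greedy embedding is an LCS-position sequence; conversely every LCS-position sequence is the
-- column sequence of an optimal chain.  Hence the first LCS-position sequence of a box is the
-- lexicographically least column sequence of an optimal chain of the box.
--
-- Least optimal chains E₁ of X′ × Y′ and E₂ of X″ × Y″ concatenate to an optimal chain of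
-- X̃ × Ỹ, since ȷ̄ is an optimal split.  Since ȷ̄ is the least optimal split, an optimal chain of
-- X̃ × Ỹ can only pass into the rows of X″ above column ȷ̄.  With this, at a first difference
-- between the least optimal chain of X̃ × Ỹ and E₁ ++ E₂ the tails can be exchanged, producing
-- either a lexicographically smaller optimal chain of X′ × Y′ or X″ × Y″, or a chain of X̃ × Ỹ
-- longer than L(X̃, Ỹ).

module Submission where

open import Defs
open import Data.Empty using (⊥-elim)
open import Data.Nat using (ℕ; zero; suc; _+_; _∸_; _≤_; _<_; ⌊_/2⌋; z≤n; s≤s; _<?_; _≤?_)
  renaming (_≟_ to _≟ℕ_)
open import Data.Nat.Properties
open import Data.Fin using (Fin; toℕ) renaming (zero to fzero; suc to fsuc)
open import Data.List using (List; []; _∷_; _++_; length; take; drop; map; filter; lookup)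
open import Data.List.Properties
  using (length-++; length-map; ∷ʳ-++; map-++; ∷-injective; ∷-injectiveˡ; ∷-injectiveʳ;
         drop-drop; take-[]; drop-[])
open import Data.List.Membership.Propositional using (_∈_)
open import Data.List.Membership.Propositional.Properties
  using (∈-++⁺ˡ; ∈-++⁺ʳ; ∈-++⁻; ∈-map⁺; ∈-map⁻; ∈-filter⁺; ∈-filter⁻)
open import Data.List.Relation.Unary.Any using (here; there)
open import Data.List.Relation.Unary.All using (All; []; _∷_)
import Data.List.Relation.Unary.All as All
import Data.List.Relation.Unary.All.Properties as Allₚ
open import Data.List.Relation.Unary.AllPairs using (AllPairs; []; _∷_)
import Data.List.Relation.Unary.AllPairs.Properties as AllPairsₚ
open import Data.List.Relation.Unary.Linked.Properties using (AllPairs⇒Linked; Linked⇒AllPairs)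
open import Data.List.Relation.Binary.Pointwise.Properties using (Pointwise-length)
open import Data.List.Relation.Binary.Pointwise using (Pointwise; []; _∷_)
open import Data.List.Relation.Binary.Lex.Core using (base; this; next)
import Data.List.Relation.Binary.Lex.NonStrict as Lex
open import Data.Unit using (tt)
open import Data.List.Relation.Binary.Sublist.Propositional using (_⊆_; []; _∷_; _∷ʳ_; minimum; ⊆-refl)
import Data.List.Relation.Binary.Sublist.Heterogeneous.Properties as Sublist
import Data.List.Relation.Binary.Sublist.DecPropositional as DecSublist
open import Data.Product using (_×_; _,_; proj₁; proj₂; ∃-syntax)
open import Data.Sum using (_⊎_; inj₁; inj₂)
open import Relation.Binary.Definitions using (DecidableEquality)
open import Relation.Binary.PropositionalEquality
open import Relation.Nullary using (¬_; Dec; yes; no)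
open import Relation.Nullary.Decidable using (_×-dec_)

variable
  A : Set

take-+ : ∀ m n (xs : List A) → take (m + n) xs ≡ take m xs ++ take n (drop m xs)
take-+ zero    n xs       = refl
take-+ (suc m) n []       = sym (take-[] n)
take-+ (suc m) n (x ∷ xs) = cong (x ∷_) (take-+ m n xs)

Pointwise-take : ∀ {B C : Set} {R : B → C → Set} n {xs ys} →
                 Pointwise R xs ys → Pointwise R (take n xs) (take n ys)
Pointwise-take zero    _          = []
Pointwise-take (suc n) []         = []
Pointwise-take (suc n) (r ∷ rs)   = r ∷ Pointwise-take n rs

Pointwise-≤-All : ∀ {m} {xs ys : List ℕ} → Pointwise _≤_ xs ys → All (_≤ m) ys → All (_≤ m) xs
Pointwise-≤-All []           []           = []
Pointwise-≤-All (x≤y ∷ xs≤ys) (y≤m ∷ ys≤m) = ≤-trans x≤y y≤m ∷ Pointwise-≤-All xs≤ys ys≤m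

All-take-lookup : ∀ {B : Set} {P : B → Set} (xs : List B) (k : Fin (length xs)) →
                  All P (take (suc (toℕ k)) xs) → P (lookup xs k)
All-take-lookup (x ∷ xs) fzero    (px ∷ _)  = px
All-take-lookup (x ∷ xs) (fsuc k) (_ ∷ pxs) = All-take-lookup xs k pxs

take-≤-lookup : (xs : List ℕ) → AllPairs _<_ xs → (k : Fin (length xs)) →
                All (_≤ lookup xs k) (take (suc (toℕ k)) xs)
take-≤-lookup (x ∷ xs) _           fzero    = ≤-refl ∷ []
take-≤-lookup (x ∷ xs) (x<xs ∷ xs↑) (fsuc k) =
  <⇒≤ (All-take-lookup xs k (Allₚ.take⁺ (suc (toℕ k)) x<xs)) ∷ take-≤-lookup xs xs↑ k

AllPairs-++⁻ : ∀ {B : Set} {R : B → B → Set} xs {ys} → AllPairs R (xs ++ ys) →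
               AllPairs R xs × AllPairs R ys × All (λ x → All (R x) ys) xs
AllPairs-++⁻ []       xys↑              = [] , xys↑ , []
AllPairs-++⁻ (x ∷ xs) (x<xys ∷ xys↑) with AllPairs-++⁻ xs xys↑
... | xs↑ , ys↑ , xs<ys = Allₚ.++⁻ˡ xs x<xys ∷ xs↑ , ys↑ , Allₚ.++⁻ʳ xs x<xys ∷ xs<ys

length-++-cong : ∀ {B : Set} (P Q U V : List B) → length P ≡ length Q → length U ≡ length V →
                 length (P ++ U) ≡ length (Q ++ V)
length-++-cong P Q _ _ |P|≡|Q| |U|≡|V| =
  trans (length-++ P) (trans (cong₂ _+_ |P|≡|Q| |U|≡|V|) (sym (length-++ Q)))

length-++-< : ∀ {B : Set} (P Q U V : List B) → length P ≡ length Q → length U < length V →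
              length (P ++ U) < length (Q ++ V)
length-++-< P Q U V |P|≡|Q| |U|<|V| = begin-strict
  length (P ++ U)      ≡⟨ length-++ P ⟩
  length P + length U  <⟨ +-mono-≤-< (≤-reflexive |P|≡|Q|) |U|<|V| ⟩
  length Q + length V  ≡⟨ sym (length-++ Q) ⟩
  length (Q ++ V)      ∎
  where open ≤-Reasoning

length-++-shift : ∀ {B C : Set} {f : B → C} {n} P Q R W → length R ≡ n →
                  map f P ≡ map f (R ++ Q) → length (P ++ W) ≡ n + length (Q ++ W)
length-++-shift {f = f} {n} P Q R W |R|≡n P≈RQ = begin
  length (P ++ W)                  ≡⟨ length-++ P ⟩
  length P + length W              ≡⟨ cong (_+ length W) |P|≡ ⟩
  (n + length Q) + length W        ≡⟨ +-assoc n (length Q) (length W) ⟩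
  n + (length Q + length W)        ≡⟨ cong (n +_) (sym (length-++ Q)) ⟩
  n + length (Q ++ W)              ∎
  where
  open ≡-Reasoning
  |P|≡ : length P ≡ n + length Q
  |P|≡ = begin
    length P                 ≡⟨ sym (length-map f P) ⟩
    length (map f P)         ≡⟨ cong length P≈RQ ⟩
    length (map f (R ++ Q))  ≡⟨ length-map f (R ++ Q) ⟩
    length (R ++ Q)          ≡⟨ length-++ R ⟩
    length R + length Q      ≡⟨ cong (_+ length Q) |R|≡n ⟩
    n + length Q             ∎

++-∷-split : ∀ {B : Set} P Q U {e : B} {V} → U ++ e ∷ V ≡ P ++ Q →
             (∃[ W ] P ≡ U ++ e ∷ W) ⊎ (∃[ U′ ] U ≡ P ++ U′ × Q ≡ U′ ++ e ∷ V)
++-∷-split []      Q U       eq = inj₂ (U , refl , sym eq)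
++-∷-split (p ∷ P) Q []      eq with ∷-injective eq
... | refl , _ = inj₁ (P , refl)
++-∷-split (p ∷ P) Q (u ∷ U) eq with ∷-injective eq
... | refl , eq′ with ++-∷-split P Q U eq′
...   | inj₁ (W , refl)       = inj₁ (W , refl)
...   | inj₂ (U′ , refl , Q≡) = inj₂ (U′ , refl , Q≡)

⌊+/2⌋-between : ∀ {a b} → a ≤ b → a ≤ ⌊ a + b /2⌋ × ⌊ a + b /2⌋ ≤ b
⌊+/2⌋-between {a} {b} a≤b =
  subst (_≤ ⌊ a + b /2⌋) (sym (n≡⌊n+n/2⌋ a)) (⌊n/2⌋-mono (+-monoʳ-≤ a a≤b)) ,
  subst (⌊ a + b /2⌋ ≤_) (sym (n≡⌊n+n/2⌋ b)) (⌊n/2⌋-mono (+-monoˡ-≤ b a≤b))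

-- Longest common subsequences

∈-subseqs⁺ : {s U : List A} → s ⊆ U → s ∈ subseqs U
∈-subseqs⁺ []                  = here refl
∈-subseqs⁺ (_∷ʳ_ {ys = U} u p) = ∈-++⁺ʳ (map (u ∷_) (subseqs U)) (∈-subseqs⁺ p)
∈-subseqs⁺ (refl ∷ p)          = ∈-++⁺ˡ (∈-map⁺ (_ ∷_) (∈-subseqs⁺ p))

∈-subseqs⁻ : (U : List A) {s : List A} → s ∈ subseqs U → s ⊆ U
∈-subseqs⁻ []      (here refl) = []
∈-subseqs⁻ (u ∷ U) s∈ with ∈-++⁻ (map (u ∷_) (subseqs U)) s∈
... | inj₂ s∈U = u ∷ʳ ∈-subseqs⁻ U s∈U
... | inj₁ s∈u∷U with ∈-map⁻ (u ∷_) s∈u∷U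
...   | _ , s∈U , refl = refl ∷ ∈-subseqs⁻ U s∈U

≤-maximum : ∀ {n} ns → n ∈ ns → n ≤ maximum ns
≤-maximum (n ∷ ns) (here refl) = m≤m⊔n n (maximum ns)
≤-maximum (m ∷ ns) (there n∈) = ≤-trans (≤-maximum ns n∈) (m≤n⊔m m (maximum ns))

maximum-∈ : ∀ ns → maximum ns ≡ 0 ⊎ maximum ns ∈ ns
maximum-∈ []       = inj₁ refl
maximum-∈ (n ∷ ns) with ⊔-sel n (maximum ns)
... | inj₁ max≡n = inj₂ (here max≡n)
... | inj₂ max≡rest with maximum-∈ ns
...   | inj₁ ≡0  = inj₁ (trans max≡rest ≡0)
...   | inj₂ ∈ns = inj₂ (subst (_∈ n ∷ ns) (sym max≡rest) (there ∈ns))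

module _ (_≟_ : DecidableEquality A) where

  private
    _⊆?_ : (s V : List A) → Dec (s ⊆ V)
    _⊆?_ = DecSublist._⊆?_ _≟_

    common : List A → List A → List (List A)
    common U V = filter (_⊆? V) (subseqs U)

  common-length≤L : {s U V : List A} → s ⊆ U → s ⊆ V → length s ≤ L _≟_ U V
  common-length≤L {U = U} {V} s⊆U s⊆V =
    ≤-maximum (map length (common U V)) (∈-map⁺ length (∈-filter⁺ (_⊆? V) (∈-subseqs⁺ s⊆U) s⊆V))

  L-attained : (U V : List A) → ∃[ s ] s ⊆ U × s ⊆ V × length s ≡ L _≟_ U V
  L-attained U V with maximum-∈ (map length (common U V))
  ... | inj₁ L≡0 = [] , minimum U , minimum V , sym L≡0
  ... | inj₂ L∈ with ∈-map⁻ length L∈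
  ...   | s , s∈ , L≡ with ∈-filter⁻ (_⊆? V) {xs = subseqs U} s∈
  ...     | s∈U , s⊆V = s , ∈-subseqs⁻ U s∈U , s⊆V , sym L≡

  L-++ : (U₁ U₂ V₁ V₂ : List A) → L _≟_ U₁ V₁ + L _≟_ U₂ V₂ ≤ L _≟_ (U₁ ++ U₂) (V₁ ++ V₂)
  L-++ U₁ U₂ V₁ V₂ with L-attained U₁ V₁ | L-attained U₂ V₂
  ... | s₁ , s₁⊆U₁ , s₁⊆V₁ , |s₁| | s₂ , s₂⊆U₂ , s₂⊆V₂ , |s₂| =
    subst (_≤ L _≟_ (U₁ ++ U₂) (V₁ ++ V₂)) (trans (length-++ s₁) (cong₂ _+_ |s₁| |s₂|))
      (common-length≤L (Sublist.++⁺ s₁⊆U₁ s₂⊆U₂) (Sublist.++⁺ s₁⊆V₁ s₂⊆V₂))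

-- Occurrences of a word at increasing positions

sub-++ : (Z : List A) {a b c : ℕ} → a ≤ b → b ≤ c →
         sub Z (suc a) c ≡ sub Z (suc a) b ++ sub Z (suc b) c
sub-++ Z {a} {b} {c} a≤b b≤c = begin
  take (c ∸ a) (drop a Z)
    ≡⟨ cong (λ n → take n (drop a Z)) c∸a≡ ⟩
  take ((b ∸ a) + (c ∸ b)) (drop a Z)
    ≡⟨ take-+ (b ∸ a) (c ∸ b) (drop a Z) ⟩
  take (b ∸ a) (drop a Z) ++ take (c ∸ b) (drop (b ∸ a) (drop a Z))
    ≡⟨ cong (λ W → take (b ∸ a) (drop a Z) ++ take (c ∸ b) W) drop-b ⟩
  take (b ∸ a) (drop a Z) ++ take (c ∸ b) (drop b Z)
    ∎
  where
  open ≡-Reasoning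
  c∸a≡ : c ∸ a ≡ (b ∸ a) + (c ∸ b)
  c∸a≡ = trans (cong (_∸ a) (sym (m+[n∸m]≡n b≤c))) (+-∸-comm (c ∸ b) a≤b)
  drop-b : drop (b ∸ a) (drop a Z) ≡ drop b Z
  drop-b = trans (drop-drop a (b ∸ a) Z) (cong (λ n → drop n Z) (m+[n∸m]≡n a≤b))

-- Positions are 1-based: sub Z (suc a) b is the part of Z at the positions i with Within a b i.
Within : ℕ → ℕ → ℕ → Set
Within a b i = a < i × i ≤ b

At : List A → ℕ → A → Set
At Z i c = sub Z i i ≡ c ∷ []

record Embedding (Z : List A) (a b : ℕ) (I : List ℕ) (s : List A) : Set where
  constructor embedding
  field
    increasing : AllPairs _<_ I
    within     : All (Within a b) I
    spells     : Pointwise (At Z) I s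

select-⊆-sub : (Z : List A) {a b : ℕ} {I : List ℕ} →
               AllPairs _<_ I → All (Within a b) I → select Z I ⊆ sub Z (suc a) b
select-⊆-sub Z []          []                          = minimum _
select-⊆-sub Z {a} {b} {suc i ∷ I} (i<I ∷ I↑) ((s≤s a≤i , i<b) ∷ I∈) =
  subst (select Z (suc i ∷ I) ⊆_) (sym split)
    (Sublist.++⁺ (minimum (sub Z (suc a) i)) (Sublist.++⁺ ⊆-refl (select-⊆-sub Z I↑ I∈′)))
  where
  split : sub Z (suc a) b ≡ sub Z (suc a) i ++ (sub Z (suc i) (suc i) ++ sub Z (suc (suc i)) b)
  split = trans (sub-++ Z a≤i (<⇒≤ i<b)) (cong (sub Z (suc a) i ++_) (sub-++ Z (n≤1+n i) i<b))
  I∈′ : All (Within (suc i) b) I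
  I∈′ = All.zipWith (λ (i< , _ , ≤b) → i< , ≤b) (i<I , I∈)

Embedding-mono : ∀ {Z : List A} {a a′ b b′ I s} → a′ ≤ a → b ≤ b′ →
                 Embedding Z a b I s → Embedding Z a′ b′ I s
Embedding-mono a′≤a b≤b′ (embedding I↑ I∈ ats) =
  embedding I↑ (All.map (λ (a< , ≤b) → ≤-<-trans a′≤a a< , ≤-trans ≤b b≤b′) I∈) ats

Embedding-∷ : ∀ {z : A} {Z a b I s} → Embedding Z a b I s →
              Embedding (z ∷ Z) (suc a) (suc b) (map suc I) s
Embedding-∷ (embedding [] [] []) = embedding [] [] []
Embedding-∷ (embedding (i<I ∷ I↑) ((s≤s a≤i , i≤b) ∷ I∈) (at ∷ ats))
  with Embedding-∷ (embedding I↑ I∈ ats)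
... | embedding I↑′ I∈′ ats′ =
  embedding (Allₚ.map⁺ (All.map s≤s i<I) ∷ I↑′) ((s≤s (s≤s a≤i) , s≤s i≤b) ∷ I∈′) (at ∷ ats′)

⊆-sub⇒embedding : (Z : List A) (a b : ℕ) {s : List A} →
                  s ⊆ sub Z (suc a) b → ∃[ I ] Embedding Z a b I s
⊆-sub⇒embedding Z       (suc a) zero    []  = [] , embedding [] [] []
⊆-sub⇒embedding []      a       b       s⊆
  with subst (_ ⊆_) (trans (cong (take (b ∸ a)) (drop-[] a)) (take-[] (b ∸ a))) s⊆
... | [] = [] , embedding [] [] []
⊆-sub⇒embedding (z ∷ Z) (suc a) (suc b) s⊆ with ⊆-sub⇒embedding Z a b s⊆
... | I , e = map suc I , Embedding-∷ e
⊆-sub⇒embedding (z ∷ Z) zero    zero    []  = [] , embedding [] [] []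
⊆-sub⇒embedding (z ∷ Z) zero    (suc b) (.z ∷ʳ s⊆) with ⊆-sub⇒embedding Z zero b s⊆
... | I , e = map suc I , Embedding-mono z≤n ≤-refl (Embedding-∷ e)
⊆-sub⇒embedding (z ∷ Z) zero    (suc b) (refl ∷ s⊆) with ⊆-sub⇒embedding Z zero b s⊆
... | I , e with Embedding-∷ {z = z} e
...   | embedding I↑ I∈ ats =
  1 ∷ map suc I , embedding (All.map proj₁ I∈ ∷ I↑)
                             ((s≤s z≤n , s≤s z≤n) ∷ All.map (λ (a< , ≤b) → <⇒≤ a< , ≤b) I∈)
                             (refl ∷ ats)

spells⇒select : ∀ {Z : List A} {I s} → Pointwise (At Z) I s → select Z I ≡ s
spells⇒select []           = refl
spells⇒select (at ∷ ats) = cong₂ _++_ at (spells⇒select ats)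

Embedding⇒⊆ : ∀ {Z : List A} {a b I s} → Embedding Z a b I s → s ⊆ sub Z (suc a) b
Embedding⇒⊆ {Z = Z} (embedding I↑ I∈ ats) = subst (_⊆ _) (spells⇒select ats) (select-⊆-sub Z I↑ I∈)

sub-singleton : (Z : List A) {i : ℕ} → Within 0 (length Z) i → ∃[ c ] At Z i c
sub-singleton (z ∷ Z) {1}           _            = z , refl
sub-singleton (z ∷ Z) {suc (suc i)} (_ , s≤s i<) = sub-singleton Z (s≤s z≤n , i<)

select-spells : (Z : List A) {I : List ℕ} → All (Within 0 (length Z)) I → Pointwise (At Z) I (select Z I)
select-spells Z []                  = []
select-spells Z {i ∷ I} (i∈ ∷ I∈) with sub-singleton Z i∈
... | c , at rewrite at = at ∷ select-spells Z I∈

At-[] : ∀ {i} {c : A} → ¬ At [] i c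
At-[] {i = i} at with trans (sym (trans (cong (take (suc i ∸ i)) (drop-[] (i ∸ 1))) (take-[] (suc i ∸ i))))
                          at
... | ()

At-drop : (Z : List A) (a : ℕ) {w : A} {W : List A} → drop a Z ≡ w ∷ W → At Z (suc a) w
At-drop Z a eq = trans (cong (λ n → take n (drop a Z)) (m+n∸n≡m 1 a)) (cong (take 1) eq)

At-drop-[] : (Z : List A) {a i : ℕ} {c : A} → a < i → At Z i c → drop a Z ≢ []
At-drop-[] []      {i = i} a<i at _ = At-[] {i = i} at
At-drop-[] (z ∷ Z) {zero}  a<i at ()
At-drop-[] (z ∷ Z) {suc a} {suc (suc i)} (s≤s a<i) at = At-drop-[] Z {a} {suc i} a<i at

drop-∷ : (Z : List A) (a : ℕ) {w : A} {W : List A} → drop a Z ≡ w ∷ W → drop (suc a) Z ≡ W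
drop-∷ []      zero    ()
drop-∷ []      (suc a) ()
drop-∷ (z ∷ Z) zero    refl = refl
drop-∷ (z ∷ Z) (suc a) eq   = drop-∷ Z a eq

Embedding-length : ∀ {Z : List A} {a b I s} → Embedding Z a b I s → length s ≡ length I
Embedding-length (embedding _ _ ats) = sym (Pointwise-length ats)

-- Greedy embeddings

module Greedy (_≟_ : DecidableEquality A) where

  -- The leftmost positions of s in W, numbering the letters of W from a + 1 (W is drop a Z).
  greedy : List A → List A → ℕ → List ℕ
  greedy []      W       a = []
  greedy (c ∷ s) []      a = []
  greedy (c ∷ s) (w ∷ W) a with c ≟ w
  ... | yes _ = suc a ∷ greedy s W (suc a)
  ... | no  _ = greedy (c ∷ s) W (suc a)

  greedy-take : ∀ n s W a → greedy (take n s) W a ≡ take n (greedy s W a)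
  greedy-take zero    s       W       a = refl
  greedy-take (suc n) []      W       a = refl
  greedy-take (suc n) (c ∷ s) []      a = refl
  greedy-take (suc n) (c ∷ s) (w ∷ W) a with c ≟ w
  ... | yes _ = cong (suc a ∷_) (greedy-take n s W (suc a))
  ... | no  _ = greedy-take (suc n) (c ∷ s) W (suc a)

  greedy-leftmost : ∀ {Z : List A} {a b I s} W → W ≡ drop a Z → Embedding Z a b I s →
                    Embedding Z a b (greedy s W a) s × Pointwise _≤_ (greedy s W a) I
  greedy-leftmost W _ (embedding [] [] []) = embedding [] [] [] , []
  greedy-leftmost {Z} [] W≡ (embedding (_ ∷ _) ((a<i , _) ∷ _) (at ∷ _)) =
    ⊥-elim (At-drop-[] Z a<i at (sym W≡))
  greedy-leftmost {Z} {a} {b} {i ∷ I} {c ∷ s} (w ∷ W) W≡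
                  (embedding (i<I ∷ I↑) ((a<i , i≤b) ∷ I∈) (at ∷ ats)) with c ≟ w
  ... | yes refl with greedy-leftmost W (sym (drop-∷ Z a (sym W≡))) (embedding I↑ I∈′ ats)
    where
    I∈′ : All (Within (suc a) b) I
    I∈′ = All.zipWith (λ (i< , _ , ≤b) → ≤-<-trans a<i i< , ≤b) (i<I , I∈)
  ...   | embedding G↑ G∈ gts , G≤I =
    embedding (All.map proj₁ G∈ ∷ G↑)
              ((≤-refl , ≤-trans a<i i≤b) ∷ All.map (λ (a< , ≤b) → <-trans (n<1+n a) a< , ≤b) G∈)
              (At-drop Z a (sym W≡) ∷ gts) ,
    a<i ∷ G≤I
  greedy-leftmost {Z} {a} {b} {i ∷ I} {c ∷ s} (w ∷ W) W≡
                  (embedding (i<I ∷ I↑) ((a<i , i≤b) ∷ I∈) (at ∷ ats))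
    | no c≢w
    with greedy-leftmost W (sym (drop-∷ Z a (sym W≡)))
           (embedding (i<I ∷ I↑) ((a+1<i , i≤b) ∷ I∈′) (at ∷ ats))
    where
    a+1<i : suc a < i
    a+1<i with m≤n⇒m<n∨m≡n a<i
    ... | inj₁ a+1<i = a+1<i
    ... | inj₂ refl = ⊥-elim (c≢w (∷-injectiveˡ (trans (sym at) (At-drop Z a (sym W≡)))))
    I∈′ : All (Within (suc a) b) I
    I∈′ = All.zipWith (λ (i< , _ , ≤b) → <-trans a+1<i i< , ≤b) (i<I , I∈)
  ... | G , G≤I = Embedding-mono (n≤1+n a) ≤-refl G , G≤I

  greedy-take-≤ : (Z : List A) (a n m : ℕ) {s : List A} {J : List ℕ} →
                  Embedding Z a m J (take n s) → All (_≤ m) (take n (greedy s (drop a Z) a))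
  greedy-take-≤ Z a n m {s} e@(embedding _ J∈ _) =
    subst (All (_≤ m)) (greedy-take n s (drop a Z) a)
      (Pointwise-≤-All (proj₂ (greedy-leftmost (drop a Z) refl e)) (All.map proj₂ J∈))

  greedy-isLCSPos : (X̃ Y : List A) (a b : ℕ) {s : List A} → IsLCS _≟_ s X̃ (sub Y (suc a) b) →
                    IsLCSPos _≟_ X̃ Y (suc a) b (greedy s (drop a Y) a)
  greedy-isLCSPos X̃ Y a b {s} lcs@(_ , s⊆Ỹ , |s|≡L) with ⊆-sub⇒embedding Y a b s⊆Ỹ
  ... | _ , e with greedy-leftmost (drop a Y) refl e
  ... | embedding R↑ R∈ rts , _ =
    trans (Pointwise-length rts) |s|≡L ,
    AllPairs⇒Linked R↑ ,
    R∈ ,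
    subst (λ t → IsLCS _≟_ t X̃ (sub Y (suc a) b)) (sym (spells⇒select rts)) lcs ,
    λ k → prefix-within k , prefix-earliest k
    where
    R : List ℕ
    R = greedy s (drop a Y) a
    prefix-within : (k : Fin (length R)) →
                    select Y (take (suc (toℕ k)) R) ⊆ sub Y (suc a) (lookup R k)
    prefix-within k =
      select-⊆-sub Y (AllPairsₚ.take⁺ (suc (toℕ k)) R↑)
        (All.zipWith (λ ((a< , _) , ≤Rk) → a< , ≤Rk)
          (Allₚ.take⁺ (suc (toℕ k)) R∈ , take-≤-lookup R R↑ k))
    prefix-earliest : (k : Fin (length R)) (m : ℕ) → m < lookup R k →
                      ¬ (select Y (take (suc (toℕ k)) R) ⊆ sub Y (suc a) m)
    prefix-earliest k m m<Rk R⊆ with ⊆-sub⇒embedding Y a m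
      (subst (_⊆ sub Y (suc a) m) (spells⇒select (Pointwise-take (suc (toℕ k)) rts)) R⊆)
    ... | _ , e′ = <⇒≱ m<Rk (All-take-lookup R k (greedy-take-≤ Y a (suc (toℕ k)) m e′))

-- Lexicographic order

≤lex-trans : {xs ys zs : List ℕ} → xs ≤lex ys → ys ≤lex zs → xs ≤lex zs
≤lex-trans = Lex.≤-transitive ≤-isPartialOrder

Pointwise⇒≤lex : {xs ys : List ℕ} → Pointwise _≤_ xs ys → xs ≤lex ys
Pointwise⇒≤lex []                        = base tt
Pointwise⇒≤lex {x ∷ _} {y ∷ _} (x≤y ∷ xs≤ys) with x ≟ℕ y
... | yes refl = next refl (Pointwise⇒≤lex xs≤ys)
... | no  x≢y  = this (x≤y , x≢y)

data FirstDifference {B : Set} (f : B → ℕ) : List B → List B → Set where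
  first-difference : ∀ {Du Eu} d Dv e Ev → map f Du ≡ map f Eu → f d < f e →
                     FirstDifference f (Du ++ d ∷ Dv) (Eu ++ e ∷ Ev)

≤lex⇒≡⊎FirstDifference : ∀ {B : Set} (f : B → ℕ) (D E : List B) →
                         map f D ≤lex map f E → length D ≡ length E →
                         map f D ≡ map f E ⊎ FirstDifference f D E
≤lex⇒≡⊎FirstDifference f []      []      _                 _ = inj₁ refl
≤lex⇒≡⊎FirstDifference f (d ∷ D) (e ∷ E) (this (fd≤fe , fd≢fe)) _ =
  inj₂ (first-difference {Du = []} {Eu = []} d D e E refl (≤∧≢⇒< fd≤fe fd≢fe))
≤lex⇒≡⊎FirstDifference f (d ∷ D) (e ∷ E) (next fd≡fe D≤E) |D|≡|E|
  with ≤lex⇒≡⊎FirstDifference f D E D≤E (suc-injective |D|≡|E|)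
... | inj₁ D≡E = inj₁ (cong₂ _∷_ fd≡fe D≡E)
... | inj₂ (first-difference d′ Dv e′ Ev agree fd′<fe′) =
  inj₂ (first-difference {Du = d ∷ _} {Eu = e ∷ _} d′ Dv e′ Ev (cong₂ _∷_ fd≡fe agree) fd′<fe′)

FirstDifference⇒≰lex : ∀ {B : Set} {f : B → ℕ} {D E : List B} →
                       FirstDifference f D E → ¬ (map f E ≤lex map f D)
FirstDifference⇒≰lex (first-difference {[]} {[]} _ _ _ _ _ fd<fe) (this (fe≤fd , _)) =
  <⇒≱ fd<fe fe≤fd
FirstDifference⇒≰lex (first-difference {[]} {[]} _ _ _ _ _ fd<fe) (next fe≡fd _) =
  <⇒≢ fd<fe (sym fe≡fd)
FirstDifference⇒≰lex (first-difference {_ ∷ Du} {_ ∷ Eu} d Dv e Ev agree fd<fe) (this (_ , fy≢fx)) =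
  fy≢fx (sym (∷-injectiveˡ agree))
FirstDifference⇒≰lex (first-difference {_ ∷ Du} {_ ∷ Eu} d Dv e Ev agree fd<fe) (next _ E≤D) =
  FirstDifference⇒≰lex (first-difference {Du = Du} {Eu = Eu} d Dv e Ev (∷-injectiveʳ agree) fd<fe) E≤D

-- Chains of matches

Point : Set
Point = ℕ × ℕ

_≺_ : Point → Point → Set
(i , j) ≺ (i′ , j′) = i < i′ × j < j′

_≼_ : Point → Point → Set
(i , j) ≼ (i′ , j′) = i ≤ i′ × j ≤ j′

≼-refl : {p : Point} → p ≼ p
≼-refl = ≤-refl , ≤-refl

≼-trans : {p q r : Point} → p ≼ q → q ≼ r → p ≼ r
≼-trans (i≤ , j≤) (i≤′ , j≤′) = ≤-trans i≤ i≤′ , ≤-trans j≤ j≤′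

≺-trans : {p q r : Point} → p ≺ q → q ≺ r → p ≺ r
≺-trans (i< , j<) (i<′ , j<′) = <-trans i< i<′ , <-trans j< j<′

≼-≺-trans : {p q r : Point} → p ≼ q → q ≺ r → p ≺ r
≼-≺-trans (i≤ , j≤) (i< , j<) = ≤-<-trans i≤ i< , ≤-<-trans j≤ j<

≺⇒≼ : {p q : Point} → p ≺ q → p ≼ q
≺⇒≼ (i< , j<) = <⇒≤ i< , <⇒≤ j<

record Box : Set where
  constructor box
  field
    lower upper : Point

_∈□_ : Point → Box → Set
p ∈□ box l u = l ≺ p × p ≼ u

_⊑_ : Box → Box → Set
box l u ⊑ box l′ u′ = l′ ≼ l × u ≼ u′

∈□-⊑ : ∀ {b b′ p} → b ⊑ b′ → p ∈□ b → p ∈□ b′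
∈□-⊑ (l′≼l , u≼u′) (l≺p , p≼u) = ≼-≺-trans l′≼l l≺p , ≼-trans p≼u u≼u′

_≺?_ : (p q : Point) → Dec (p ≺ q)
(i , j) ≺? (i′ , j′) = (i <? i′) ×-dec (j <? j′)

⊀⇒≥₁ : {p q : Point} → ¬ p ≺ q → proj₂ p < proj₂ q → proj₁ q ≤ proj₁ p
⊀⇒≥₁ p⊀q j<j′ = ≮⇒≥ (λ i<i′ → p⊀q (i<i′ , j<j′))

⊀⇒≥₂ : {p q : Point} → ¬ p ≺ q → proj₁ p < proj₁ q → proj₂ q ≤ proj₂ p
⊀⇒≥₂ p⊀q i<i′ = ≮⇒≥ (λ j<j′ → p⊀q (i<i′ , j<j′))

module Chains (_≟_ : DecidableEquality A) (X Y : List A) where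
  open Greedy _≟_

  Match : Point → Set
  Match (i , j) = ∃[ c ] At X i c × At Y j c

  record Chain (b : Box) (D : List Point) : Set where
    constructor chain
    field
      increasing : AllPairs _≺_ D
      inside     : All (_∈□ b) D
      matching   : All Match D

  lcs : Box → ℕ
  lcs (box (i₀ , j₀) (i₁ , j₁)) = L _≟_ (sub X (suc i₀) i₁) (sub Y (suc j₀) j₁)

  record Optimal (b : Box) (D : List Point) : Set where
    constructor optimal
    field
      isChain : Chain b D
      length≡ : length D ≡ lcs b

  LCSPositions : Box → List ℕ → Set
  LCSPositions (box (i₀ , j₀) (i₁ , j₁)) = IsLCSPos _≟_ (sub X (suc i₀) i₁) Y (suc j₀) j₁

  FirstLCSPositions : Box → List ℕ → Set
  FirstLCSPositions (box (i₀ , j₀) (i₁ , j₁)) = IsFirstLCSPos _≟_ (sub X (suc i₀) i₁) Y (suc j₀) j₁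

  Chain-++⁻ : ∀ {b} U {V} → Chain b (U ++ V) → Chain b U × Chain b V
  Chain-++⁻ U (chain UV↑ UV∈ ms) with AllPairs-++⁻ U UV↑
  ... | U↑ , V↑ , _ = chain U↑ (Allₚ.++⁻ˡ U UV∈) (Allₚ.++⁻ˡ U ms) ,
                      chain V↑ (Allₚ.++⁻ʳ U UV∈) (Allₚ.++⁻ʳ U ms)

  Chain-before : ∀ {b} U {d D} → Chain b (U ++ d ∷ D) → All (_≺ d) U
  Chain-before U (chain UdD↑ _ _) = All.map All.head (proj₂ (proj₂ (AllPairs-++⁻ U UdD↑)))

  Chain-at : ∀ {b} U {d D} → Chain b (U ++ d ∷ D) → Chain b (d ∷ [])
  Chain-at U ch = proj₁ (Chain-++⁻ (_ ∷ []) (proj₂ (Chain-++⁻ U ch)))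

  Chain-after : ∀ {b d D} → Chain b (d ∷ D) → All (d ≺_) D
  Chain-after (chain (d≺D ∷ _) _ _) = d≺D

  Chain-++⁺ : ∀ {b U V} → Chain b U → Chain b V → All (λ p → All (p ≺_) V) U → Chain b (U ++ V)
  Chain-++⁺ (chain U↑ U∈ mU) (chain V↑ V∈ mV) U≺V =
    chain (AllPairsₚ.++⁺ U↑ V↑ U≺V) (Allₚ.++⁺ U∈ V∈) (Allₚ.++⁺ mU mV)

  Chain-join : ∀ {b U d D} → Chain b U → Chain b (d ∷ D) → All (_≺ d) U → Chain b (U ++ d ∷ D)
  Chain-join chU chdD U≺d =
    Chain-++⁺ chU chdD (All.map (λ p≺d → p≺d ∷ All.map (≺-trans p≺d) (Chain-after chdD)) U≺d)

  Chain-splice : ∀ {b} U {d D V} → Chain b (U ++ d ∷ D) → Chain b (d ∷ V) → Chain b (U ++ d ∷ V)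
  Chain-splice U ch chdV = Chain-join (proj₁ (Chain-++⁻ U ch)) chdV (Chain-before U ch)

  Chain-switch : ∀ {b} U {p V q W} → Chain b (U ++ p ∷ V) → Chain b (q ∷ W) → p ≺ q →
                 Chain b (U ++ p ∷ q ∷ W)
  Chain-switch U chV chW p≺q = Chain-splice U chV (Chain-join (Chain-at U chV) chW (p≺q ∷ []))

  Chain-suffix : ∀ {b} U {d D} → Chain b (U ++ d ∷ D) → Chain b D
  Chain-suffix U ch with proj₂ (Chain-++⁻ U ch)
  ... | chain (_ ∷ D↑) (_ ∷ D∈) (_ ∷ ms) = chain D↑ D∈ ms

  Chain-⊑ : ∀ {b b′ D} → b ⊑ b′ → Chain b D → Chain b′ D
  Chain-⊑ b⊑b′ (chain D↑ D∈ ms) = chain D↑ (All.map (∈□-⊑ b⊑b′) D∈) ms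

  Chain-below : ∀ {l u u′ D} → Chain (box l u) D → All (_≼ u′) D → Chain (box l u′) D
  Chain-below (chain D↑ D∈ ms) D≼u′ =
    chain D↑ (All.zipWith (λ ((l≺q , _) , q≼u′) → l≺q , q≼u′) (D∈ , D≼u′)) ms

  Chain-above : ∀ {l l′ u D} → Chain (box l u) D → All (l′ ≺_) D → Chain (box l′ u) D
  Chain-above (chain D↑ D∈ ms) l′≺D =
    chain D↑ (All.zipWith (λ ((_ , q≼u) , l′≺q) → l′≺q , q≼u) (D∈ , l′≺D)) ms

  Chain-upto : ∀ {l u u′} U {d D} → Chain (box l u) (U ++ d ∷ D) → d ≼ u′ →
               Chain (box l u′) (U ++ d ∷ [])
  Chain-upto U ch d≼u′ =
    Chain-below (Chain-splice U ch (Chain-at U ch))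
      (Allₚ.++⁺ (All.map (λ q≺d → ≼-trans (≺⇒≼ q≺d) d≼u′) (Chain-before U ch)) (d≼u′ ∷ []))

  Chain-from : ∀ {l l′ u d D} → Chain (box l u) (d ∷ D) → l′ ≺ d → Chain (box l′ u) (d ∷ D)
  Chain-from ch l′≺d = Chain-above ch (l′≺d ∷ All.map (≺-trans l′≺d) (Chain-after ch))

  Chain-word : ∀ {i₀ j₀ i₁ j₁ D} → Chain (box (i₀ , j₀) (i₁ , j₁)) D →
               ∃[ w ] Embedding X i₀ i₁ (map proj₁ D) w × Embedding Y j₀ j₁ (map proj₂ D) w
  Chain-word (chain [] [] []) = [] , embedding [] [] [] , embedding [] [] []
  Chain-word (chain (p≺D ∷ D↑) (((i₀< , j₀<) , (≤i₁ , ≤j₁)) ∷ D∈) ((c , atX , atY) ∷ ms))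
    with Chain-word (chain D↑ D∈ ms)
  ... | w , embedding I↑ I∈ ats , embedding J↑ J∈ bts =
    c ∷ w , embedding (Allₚ.map⁺ (All.map proj₁ p≺D) ∷ I↑) ((i₀< , ≤i₁) ∷ I∈) (atX ∷ ats)
          , embedding (Allₚ.map⁺ (All.map proj₂ p≺D) ∷ J↑) ((j₀< , ≤j₁) ∷ J∈) (atY ∷ bts)

  Chain-word-length : ∀ {j₀ j₁} {D : List Point} {w : List A} →
                      Embedding Y j₀ j₁ (map proj₂ D) w → length w ≡ length D
  Chain-word-length {D = D} eY = trans (Embedding-length eY) (length-map proj₂ D)

  Chain-length≤lcs : ∀ {b D} → Chain b D → length D ≤ lcs b
  Chain-length≤lcs {b} ch with Chain-word ch
  ... | w , eX , eY =
    subst (_≤ lcs b) (Chain-word-length eY) (common-length≤L _≟_ (Embedding⇒⊆ eX) (Embedding⇒⊆ eY))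

  Optimal⇒LCSPositions-≤lex : ∀ {b D} → Optimal b D → ∃[ R ] LCSPositions b R × R ≤lex map proj₂ D
  Optimal⇒LCSPositions-≤lex {box (i₀ , j₀) (i₁ , j₁)} (optimal ch |D|≡) with Chain-word ch
  ... | w , eX , eY =
    greedy w (drop j₀ Y) j₀ ,
    greedy-isLCSPos _ Y j₀ j₁ (Embedding⇒⊆ eX , Embedding⇒⊆ eY , trans (Chain-word-length eY) |D|≡) ,
    Pointwise⇒≤lex (proj₂ (greedy-leftmost (drop j₀ Y) refl eY))

  Embeddings⇒Chain : ∀ {i₀ i₁ j₀ j₁ I J w} → Embedding X i₀ i₁ I w → Embedding Y j₀ j₁ J w →
                     ∃[ D ] Chain (box (i₀ , j₀) (i₁ , j₁)) D × map proj₁ D ≡ I × map proj₂ D ≡ J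
  Embeddings⇒Chain (embedding [] [] []) (embedding [] [] []) = [] , chain [] [] [] , refl , refl
  Embeddings⇒Chain {I = i ∷ _} {J = j ∷ _}
                   (embedding (i<I ∷ I↑) ((i₀< , ≤i₁) ∷ I∈) (atX ∷ ats))
                   (embedding (j<J ∷ J↑) ((j₀< , ≤j₁) ∷ J∈) (atY ∷ bts))
    with Embeddings⇒Chain (embedding I↑ I∈ ats) (embedding J↑ J∈ bts)
  ... | D , chain D↑ D∈ ms , refl , refl =
    (i , j) ∷ D ,
    chain (All.zipWith (λ (i< , j<) → i< , j<) (Allₚ.map⁻ i<I , Allₚ.map⁻ j<J) ∷ D↑)
          (((i₀< , j₀<) , (≤i₁ , ≤j₁)) ∷ D∈) ((_ , atX , atY) ∷ ms) ,
    refl , refl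

  LCSPositions⇒Optimal : ∀ {b P} → proj₂ (Box.upper b) ≤ length Y → LCSPositions b P →
                         ∃[ D ] Optimal b D × map proj₂ D ≡ P
  LCSPositions⇒Optimal {box (i₀ , j₀) (i₁ , j₁)} {P} j₁≤|Y| (|P|≡ , P↑ , P∈ , (w⊆X̃ , _) , _)
    with ⊆-sub⇒embedding X i₀ i₁ w⊆X̃
  ... | _ , eX with Embeddings⇒Chain eX (embedding (Linked⇒AllPairs <-trans P↑) P∈ (select-spells Y P∈′))
    where
    P∈′ : All (Within 0 (length Y)) P
    P∈′ = All.map (λ (j₀< , ≤j₁) → ≤-trans (s≤s z≤n) j₀< , ≤-trans ≤j₁ j₁≤|Y|) P∈
  ... | D , ch , _ , refl = D , optimal ch (trans (sym (length-map proj₂ D)) |P|≡) , refl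

  Least : Box → List Point → Set
  Least b E = Optimal b E × (∀ D → Optimal b D → map proj₂ E ≤lex map proj₂ D)

  FirstLCSPositions⇒Least : ∀ {b P} → proj₂ (Box.upper b) ≤ length Y → FirstLCSPositions b P →
                            ∃[ E ] Least b E × map proj₂ E ≡ P
  FirstLCSPositions⇒Least j₁≤|Y| (isP , first) with LCSPositions⇒Optimal j₁≤|Y| isP
  ... | E , oE , refl = E , (oE , E≤) , refl
    where
    E≤ : ∀ D → Optimal _ D → map proj₂ E ≤lex map proj₂ D
    E≤ D oD with Optimal⇒LCSPositions-≤lex oD
    ... | R , isR , R≤D = ≤lex-trans (first R isR) R≤D

  lcs-++ : ∀ {l c u : Point} → l ≼ c → c ≼ u → lcs (box l c) + lcs (box c u) ≤ lcs (box l u)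
  lcs-++ {i₀ , j₀} {m , t} {i₁ , j₁} (i₀≤m , j₀≤t) (m≤i₁ , t≤j₁) =
    subst₂ (λ U V → lcs (box (i₀ , j₀) (m , t)) + lcs (box (m , t) (i₁ , j₁)) ≤ L _≟_ U V)
      (sym (sub-++ X i₀≤m m≤i₁)) (sym (sub-++ Y j₀≤t t≤j₁))
      (L-++ _≟_ (sub X (suc i₀) m) (sub X (suc m) i₁) (sub Y (suc j₀) t) (sub Y (suc t) j₁))

-- Splitting at the least optimal column

module Bisection (_≟_ : DecidableEquality A) (X Y : List A) (i₀ m i₁ j₀ k j₁ : ℕ) where
  open Chains _≟_ X Y

  corner : Point
  corner = m , k

  whole left right : Box
  whole = box (i₀ , j₀) (i₁ , j₁)
  left  = box (i₀ , j₀) corner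
  right = box corner (i₁ , j₁)

  lcsˡ lcsʳ : ℕ → ℕ
  lcsˡ t = lcs (box (i₀ , j₀) (m , t))
  lcsʳ t = lcs (box (m , t) (i₁ , j₁))

  module _ (i₀≤m : i₀ ≤ m) (m≤i₁ : m ≤ i₁) (j₀≤k : j₀ ≤ k) (k≤j₁ : k ≤ j₁)
           (optimal-split : lcsˡ k + lcsʳ k ≡ lcs whole)
           (earlier-splits-suboptimal : ∀ t → j₀ ≤ t → t < k → lcsˡ t + lcsʳ t ≢ lcs whole) where

    left⊑whole : left ⊑ whole
    left⊑whole = ≼-refl , (m≤i₁ , k≤j₁)

    right⊑whole : right ⊑ whole
    right⊑whole = (i₀≤m , j₀≤k) , ≼-refl

    lcs-left≤whole : lcs left ≤ lcs whole
    lcs-left≤whole = subst (lcs left ≤_) optimal-split (m≤m+n (lcs left) (lcs right))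

    Optimal-++ : ∀ {E₁ E₂} → Optimal left E₁ → Optimal right E₂ → Optimal whole (E₁ ++ E₂)
    Optimal-++ {E₁} {E₂} (optimal ch₁ |E₁|≡) (optimal ch₂ |E₂|≡) =
      optimal (Chain-++⁺ (Chain-⊑ left⊑whole ch₁) (Chain-⊑ right⊑whole ch₂) E₁≺E₂)
              (trans (length-++ E₁) (trans (cong₂ _+_ |E₁|≡ |E₂|≡) optimal-split))
      where
      E₁≺E₂ : All (λ p → All (p ≺_) E₂) E₁
      E₁≺E₂ = All.map (λ (_ , p≼c) → All.map (λ (c≺q , _) → ≼-≺-trans p≼c c≺q) (Chain.inside ch₂))
                      (Chain.inside ch₁)

    -- Cutting the chain in front of p = (_ , t + 1) splits it into chains of the boxes
    -- below and above the corner (m , t), so column t would be an earlier optimal split.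
    first-beyond-m⇒beyond-k : ∀ D₀ p D → Optimal whole (D₀ ++ p ∷ D) → All (λ q → proj₁ q ≤ m) D₀ →
                              m < proj₁ p → k < proj₂ p
    first-beyond-m⇒beyond-k D₀ (_ , zero) D (optimal ch _) _ _
      with All.head (Allₚ.++⁻ʳ D₀ (Chain.inside ch))
    ... | (_ , ()) , _
    first-beyond-m⇒beyond-k D₀ p@(_ , suc t) D (optimal ch |D|≡) D₀≤m m<p with k <? suc t
    ... | yes k<p = k<p
    ... | no  k≮p = ⊥-elim (earlier-splits-suboptimal t j₀≤t (≮⇒≥ k≮p)
                              (≤-antisym (lcs-++ (i₀≤m , j₀≤t) (m≤i₁ , t≤j₁)) whole≤split))
      where
      p∈ : p ∈□ whole
      p∈ = All.head (Allₚ.++⁻ʳ D₀ (Chain.inside ch))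
      j₀≤t : j₀ ≤ t
      j₀≤t = ≤-pred (proj₂ (proj₁ p∈))
      t≤j₁ : t ≤ j₁
      t≤j₁ = ≤-trans (n≤1+n t) (proj₂ (proj₂ p∈))
      D₀-below : Chain (box (i₀ , j₀) (m , t)) D₀
      D₀-below = Chain-below (proj₁ (Chain-++⁻ D₀ ch))
                  (All.zipWith (λ (q≤m , q≺p) → q≤m , ≤-pred (proj₂ q≺p)) (D₀≤m , Chain-before D₀ ch))
      pD-above : Chain (box (m , t) (i₁ , j₁)) (p ∷ D)
      pD-above = Chain-from (proj₂ (Chain-++⁻ D₀ ch)) (m<p , ≤-refl)
      whole≤split : lcs whole ≤ lcsˡ t + lcsʳ t
      whole≤split = subst (_≤ lcsˡ t + lcsʳ t) (trans (sym (length-++ D₀)) |D|≡)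
                      (+-mono-≤ (Chain-length≤lcs D₀-below) (Chain-length≤lcs pD-above))

    beyond-m⇒beyond-k : ∀ D₀ D → Optimal whole (D₀ ++ D) → All (λ q → proj₁ q ≤ m) D₀ →
                        All (λ p → m < proj₁ p → k < proj₂ p) D
    beyond-m⇒beyond-k D₀ []      _  _   = []
    beyond-m⇒beyond-k D₀ (p ∷ D) oD D₀≤m with proj₁ p ≤? m
    ... | yes p≤m = (λ m<p → ⊥-elim (<⇒≱ m<p p≤m)) ∷
                    beyond-m⇒beyond-k (D₀ ++ p ∷ []) D (subst (Optimal whole) (sym (∷ʳ-++ D₀ p D)) oD)
                      (Allₚ.++⁺ D₀≤m (p≤m ∷ []))
    ... | no  p≰m = (λ _ → k<p) ∷ All.map (λ p≺q _ → <-trans k<p (proj₂ p≺q)) p≺D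
      where
      k<p : k < proj₂ p
      k<p = first-beyond-m⇒beyond-k D₀ p D oD D₀≤m (≰⇒> p≰m)
      p≺D : All (p ≺_) D
      p≺D = Chain-after (proj₂ (Chain-++⁻ D₀ (Optimal.isChain oD)))

    Optimal-beyond-m⇒beyond-k : ∀ D₀ {d D} → Optimal whole (D₀ ++ d ∷ D) → m < proj₁ d → k < proj₂ d
    Optimal-beyond-m⇒beyond-k D₀ oD = All.head (Allₚ.++⁻ʳ D₀ (beyond-m⇒beyond-k [] _ oD []))

    Optimal-below-k⇒below-m : ∀ D₀ {d D} → Optimal whole (D₀ ++ d ∷ D) → proj₂ d ≤ k → proj₁ d ≤ m
    Optimal-below-k⇒below-m D₀ oD d≤k = ≮⇒≥ (λ m<d → <⇒≱ (Optimal-beyond-m⇒beyond-k D₀ oD m<d) d≤k)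

    -- Switching from the left chain to the whole chain one step later would give a chain of the
    -- whole box one longer than the whole chain.
    no-overtaking : ∀ D₀ d d′ D E₀ e e′ E → length D₀ ≡ length E₀ →
                    Optimal whole (D₀ ++ d ∷ d′ ∷ D) → Optimal left (E₀ ++ e ∷ e′ ∷ E) → ¬ e′ ≺ d′
    no-overtaking D₀ d d′ D E₀ e e′ E |D₀|≡|E₀| (optimal chD |D|≡) (optimal chE _) e′≺d′ =
      <⇒≱ (length-++-< D₀ E₀ (d ∷ d′ ∷ D) (e ∷ e′ ∷ d′ ∷ D) |D₀|≡|E₀| (s≤s ≤-refl))
          (≤-trans (Chain-length≤lcs longer) (≤-reflexive (sym |D|≡)))
      where
      longer : Chain whole (E₀ ++ e ∷ e′ ∷ d′ ∷ D)
      longer = Chain-switch E₀ (Chain-⊑ left⊑whole chE)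
                 (Chain-switch [] (Chain-⊑ left⊑whole (Chain-suffix E₀ chE)) (Chain-suffix D₀ chD) e′≺d′)
                 (All.head (Chain-after (proj₂ (Chain-++⁻ E₀ chE))))

    -- Walk along both chains in step, keeping the point d of the first chain weakly left of the
    -- point e of the second in Y, until the first chain can switch onto the second (d ≺ e′).
    exchange-left : ∀ D₀ d D E₀ e E → length D₀ ≡ length E₀ → proj₂ d ≤ proj₂ e →
                    Optimal whole (D₀ ++ d ∷ D) → Optimal left (E₀ ++ e ∷ E) →
                    ∃[ Z ] Optimal left (D₀ ++ d ∷ Z)
    exchange-left D₀ d D E₀ e [] |D₀|≡|E₀| d≤e oD@(optimal chD _) (optimal chE |E|≡) =
      [] , optimal (Chain-upto D₀ chD (Optimal-below-k⇒below-m D₀ oD d≤k , d≤k))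
                   (trans (length-++-cong D₀ E₀ _ _ |D₀|≡|E₀| refl) |E|≡)
      where
      d≤k : proj₂ d ≤ k
      d≤k = ≤-trans d≤e (proj₂ (proj₂ (All.head (Allₚ.++⁻ʳ E₀ (Chain.inside chE)))))
    exchange-left D₀ d D E₀ e (e′ ∷ E) |D₀|≡|E₀| d≤e oD@(optimal chD |D|≡) oE@(optimal chE |E|≡)
      with d ≺? e′
    ... | yes d≺e′ =
      e′ ∷ E , optimal (Chain-switch D₀ (Chain-upto D₀ chD d≼corner) (Chain-suffix E₀ chE) d≺e′)
                       (trans (length-++-cong D₀ E₀ _ _ |D₀|≡|E₀| refl) |E|≡)
      where
      d≼corner : d ≼ corner
      d≼corner = ≼-trans (≺⇒≼ d≺e′) (proj₂ (All.head (Chain.inside (Chain-suffix E₀ chE))))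
    exchange-left D₀ d [] E₀ e (e′ ∷ E) |D₀|≡|E₀| d≤e (optimal chD |D|≡) (optimal chE |E|≡) | no _ =
      ⊥-elim (<⇒≱ (length-++-< D₀ E₀ (d ∷ []) (e ∷ e′ ∷ E) |D₀|≡|E₀| (s≤s (s≤s z≤n)))
                  (≤-trans (≤-reflexive |E|≡) (≤-trans lcs-left≤whole (≤-reflexive (sym |D|≡)))))
    exchange-left D₀ d (d′ ∷ D) E₀ e (e′ ∷ E) |D₀|≡|E₀| d≤e oD@(optimal chD |D|≡) oE@(optimal chE |E|≡)
      | no d⊀e′
      with exchange-left (D₀ ++ d ∷ []) d′ D (E₀ ++ e ∷ []) e′ E
             (length-++-cong D₀ E₀ (d ∷ []) (e ∷ []) |D₀|≡|E₀| refl) d′≤e′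
             (subst (Optimal whole) (sym (∷ʳ-++ D₀ d (d′ ∷ D))) oD)
             (subst (Optimal left) (sym (∷ʳ-++ E₀ e (e′ ∷ E))) oE)
      where
      e′≤d : proj₁ e′ ≤ proj₁ d
      e′≤d = ⊀⇒≥₁ d⊀e′ (≤-<-trans d≤e (proj₂ (All.head (Chain-after (proj₂ (Chain-++⁻ E₀ chE))))))
      d′≤e′ : proj₂ d′ ≤ proj₂ e′
      d′≤e′ = ⊀⇒≥₂ (no-overtaking D₀ d d′ D E₀ e e′ E |D₀|≡|E₀| oD oE)
                   (≤-<-trans e′≤d (proj₁ (All.head (Chain-after (proj₂ (Chain-++⁻ D₀ chD))))))
    ...   | Z , oZ = d′ ∷ Z , subst (Optimal left) (∷ʳ-++ D₀ d (d′ ∷ Z)) oZ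

    -- If d ⊀ e then d lies right of row m, hence above column k, and can replace e.
    exchange-right : ∀ D₀ d D E₁ E₀ e E → Optimal left E₁ → map proj₂ D₀ ≡ map proj₂ (E₁ ++ E₀) →
                     proj₂ d < proj₂ e → Optimal whole (D₀ ++ d ∷ D) → Optimal right (E₀ ++ e ∷ E) →
                     ∃[ Z ] Optimal right (E₀ ++ d ∷ Z)
    exchange-right D₀ d D E₁ E₀ e E (optimal _ |E₁|≡) D₀≈E₁E₀ d<e oD@(optimal chD |D|≡)
                   (optimal chE |E|≡) with d ≺? e
    ... | yes d≺e = ⊥-elim (<⇒≱ too-long (Chain-length≤lcs longer))
      where
      longer : Chain whole (D₀ ++ d ∷ e ∷ E)
      longer = Chain-switch D₀ chD (Chain-⊑ right⊑whole (proj₂ (Chain-++⁻ E₀ chE))) d≺e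
      too-long : lcs whole < length (D₀ ++ d ∷ e ∷ E)
      too-long = begin-strict
        lcs whole                            ≡⟨ sym optimal-split ⟩
        lcs left + lcs right                 ≡⟨ cong (lcs left +_) (sym |E|≡) ⟩
        lcs left + length (E₀ ++ e ∷ E)      <⟨ +-monoʳ-< (lcs left)
                                                  (length-++-< E₀ E₀ (e ∷ E) (d ∷ e ∷ E) refl ≤-refl) ⟩
        lcs left + length (E₀ ++ d ∷ e ∷ E)  ≡⟨ sym (length-++-shift D₀ E₀ E₁ (d ∷ e ∷ E) |E₁|≡ D₀≈E₁E₀) ⟩
        length (D₀ ++ d ∷ e ∷ E)             ∎
        where open ≤-Reasoning
    ... | no d⊀e =
      D , optimal (Chain-join (proj₁ (Chain-++⁻ E₀ chE))
                              (Chain-from (proj₂ (Chain-++⁻ D₀ chD)) (m<d , k<d)) E₀≺d)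
                  (+-cancelˡ-≡ (lcs left) _ _
                    (trans (sym (length-++-shift D₀ E₀ E₁ (d ∷ D) |E₁|≡ D₀≈E₁E₀))
                           (trans |D|≡ (sym optimal-split))))
      where
      e≤d : proj₁ e ≤ proj₁ d
      e≤d = ⊀⇒≥₁ d⊀e d<e
      m<d : m < proj₁ d
      m<d = <-≤-trans (proj₁ (proj₁ (All.head (Allₚ.++⁻ʳ E₀ (Chain.inside chE))))) e≤d
      k<d : k < proj₂ d
      k<d = Optimal-beyond-m⇒beyond-k D₀ oD m<d
      E₀<d : All (λ q → proj₂ q < proj₂ d) E₀
      E₀<d = Allₚ.map⁻ (Allₚ.++⁻ʳ (map proj₂ E₁)
               (subst (All (_< proj₂ d)) (trans D₀≈E₁E₀ (map-++ proj₂ E₁ E₀))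
                 (Allₚ.map⁺ (All.map proj₂ (Chain-before D₀ chD)))))
      E₀≺d : All (_≺ d) E₀
      E₀≺d = All.zipWith (λ (q≺e , q<d) → <-≤-trans (proj₁ q≺e) e≤d , q<d) (Chain-before E₀ chE , E₀<d)

    no-first-difference : ∀ {D E E₁ E₂} → Optimal whole D → Least left E₁ → Least right E₂ →
                          E ≡ E₁ ++ E₂ → ¬ FirstDifference proj₂ D E
    no-first-difference {E₁ = E₁} {E₂} oD (oE₁ , E₁-least) (oE₂ , E₂-least) E≡
                        (first-difference {Du} {Eu} d Dv e Ev agree d<e)
      with ++-∷-split E₁ E₂ Eu E≡
    ... | inj₁ (W , refl) with exchange-left Du d Dv Eu e W |Du|≡|Eu| (<⇒≤ d<e) oD oE₁
      where
      |Du|≡|Eu| : length Du ≡ length Eu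
      |Du|≡|Eu| = trans (sym (length-map proj₂ Du)) (trans (cong length agree) (length-map proj₂ Eu))
    ...   | Z , oZ = FirstDifference⇒≰lex (first-difference d Z e W agree d<e) (E₁-least _ oZ)
    no-first-difference {E₁ = E₁} oD (oE₁ , _) (oE₂ , E₂-least) _
                        (first-difference {Du} d Dv e Ev agree d<e)
      | inj₂ (U , refl , refl) with exchange-right Du d Dv E₁ U e Ev oE₁ agree d<e oD oE₂
    ...   | Z , oZ =
      FirstDifference⇒≰lex (first-difference {Du = U} {Eu = U} d Z e Ev refl d<e) (E₂-least _ oZ)

    Least-++ : ∀ {D E₁ E₂} → Least whole D → Least left E₁ → Least right E₂ →
               map proj₂ D ≡ map proj₂ (E₁ ++ E₂)
    Least-++ {D} {E₁} {E₂} (oD , D-least) E₁-least@(oE₁ , _) E₂-least@(oE₂ , _)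
      with ≤lex⇒≡⊎FirstDifference proj₂ D (E₁ ++ E₂) (D-least _ (Optimal-++ oE₁ oE₂))
             (trans (Optimal.length≡ oD) (sym (Optimal.length≡ (Optimal-++ oE₁ oE₂))))
    ... | inj₁ D≈E  = D≈E
    ... | inj₂ diff = ⊥-elim (no-first-difference oD E₁-least E₂-least refl diff)

    FirstLCSPositions-++ : j₁ ≤ length Y → ∀ {P̃ P′ P″} → FirstLCSPositions whole P̃ →
                           FirstLCSPositions left P′ → FirstLCSPositions right P″ → P̃ ≡ P′ ++ P″
    FirstLCSPositions-++ j₁≤|Y| F̃ F′ F″
      with FirstLCSPositions⇒Least j₁≤|Y| F̃ | FirstLCSPositions⇒Least (≤-trans k≤j₁ j₁≤|Y|) F′
         | FirstLCSPositions⇒Least j₁≤|Y| F″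
    ... | D , D-least , refl | E₁ , E₁-least , refl | E₂ , E₂-least , refl =
      trans (Least-++ D-least E₁-least E₂-least) (map-++ proj₂ E₁ E₂)

lemma5 : {A : Set} (_≟_ : DecidableEquality A) (X Y : List A)
         (i' i'' j' j'' : ℕ) →
         1 ≤ i' → i' < i'' → i'' ≤ length X →
         1 ≤ j' → j' ≤ suc j'' → j'' ≤ length Y →
         (jbar : ℕ) →
         j' ∸ 1 ≤ jbar → jbar ≤ j'' →
         L _≟_ (sub X i' ⌊ i' + i'' /2⌋) (sub Y j' jbar)
           + L _≟_ (sub X (suc ⌊ i' + i'' /2⌋) i'') (sub Y (suc jbar) j'')
           ≡ L _≟_ (sub X i' i'') (sub Y j' j'') →
         ((j : ℕ) → j' ∸ 1 ≤ j → j < jbar →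
           ¬ (L _≟_ (sub X i' ⌊ i' + i'' /2⌋) (sub Y j' j)
                + L _≟_ (sub X (suc ⌊ i' + i'' /2⌋) i'') (sub Y (suc j) j'')
                ≡ L _≟_ (sub X i' i'') (sub Y j' j''))) →
         (P̃ P' P'' : List ℕ) →
         IsFirstLCSPos _≟_ (sub X i' i'') Y j' j'' P̃ →
         IsFirstLCSPos _≟_ (sub X i' ⌊ i' + i'' /2⌋) Y j' jbar P' →
         IsFirstLCSPos _≟_ (sub X (suc ⌊ i' + i'' /2⌋) i'') Y (suc jbar) j'' P'' →
         P̃ ≡ P' ++ P''
lemma5 _≟_ X Y (suc i₀) i₁ (suc j₀) j₁ (s≤s z≤n) i′<i₁ _ (s≤s z≤n) _ j₁≤|Y| k j₀≤k k≤j₁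
       optimal-split earlier-splits-suboptimal _ _ _ =
  FirstLCSPositions-++ (≤-trans (n≤1+n i₀) i′≤mid) mid≤i₁ j₀≤k k≤j₁
    optimal-split earlier-splits-suboptimal j₁≤|Y|
  where
  mid : ℕ
  mid = ⌊ suc i₀ + i₁ /2⌋
  open Bisection _≟_ X Y i₀ mid i₁ j₀ k j₁
  i′≤mid : suc i₀ ≤ mid
  i′≤mid = proj₁ (⌊+/2⌋-between (<⇒≤ i′<i₁))
  mid≤i₁ : mid ≤ i₁
  mid≤i₁ = proj₂ (⌊+/2⌋-between (<⇒≤ i′<i₁))
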